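{- Let $G=(V,E)$ be a graph with $n=|V|$ and $k$ a nonnegative integer. Suppose that $h_1(\pi)>k$ for every extreme 2-partition $\pi$ of $V$. If there exists a non-trivial and non-extreme 2-partition $\pi$ of $V$ with $h_1(\pi)\le k$, then there exist a vertex $s\in V$ and a $(k,t)$-feasible flipping set $F$ for $\pi_0=(N_G[s],V\setminus N_G[s])$ with $|F|\le f$, where $t=(n-1)/2$ and $f=k/n$.
   Context: $N_G[s]$ is the closed neighborhood $\{u:(u,s)\in E\}\cup\{s\}$. A 2-partition of $V$ is an unordered pair $\pi=(V_1,V_2)$ with $V_1\cap V_2=\emptyset$, $V_1\cup V_2=V$; it is trivial if $V_1$ or $V_2$ is empty, and extreme if $|V_1|=1$ or $|V_2|=1$. Two distinct vertices $u,v$ are in conflict in $\pi$ if they are in the same cluster and $(u,v)\notin E$, or in different clusters and $(u,v)\in E$; $c_\pi(v)$ is the number of vertices in conflict with $v$, and $h_1(\pi)=\sum_{v\in V}c_\pi(v)$. Flipping $F\subseteq V$ turns $\pi=(V_1,V_2)$ into $\pi\ominus F=(V_1\ominus F,V_2\ominus F)$ ($\ominus$ = symmetric difference). A set $F\subseteq V$ is a $(K,t)$-feasible flipping set for $\pi$ if, with $\pi'=\pi\ominus F$, $\sum_{v\in V}c_{\pi'}(v)\le K$ and $c_{\pi'}(v)\le t$ for every $v\in V$. -}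

module Defs where

open import Data.Bool using (Bool; true; false; not; _∧_; _xor_; if_then_else_)
open import Data.Nat using (ℕ; zero; suc; _+_; _*_; _≤_)
open import Data.Fin using (Fin; zero; suc; _≟_)
open import Data.Fin.Subset using (Subset)
open import Data.Vec using (lookup)
open import Data.Product using (_×_)
open import Data.Sum using (_⊎_)
open import Relation.Binary.PropositionalEquality using (_≡_)
open import Relation.Nullary.Decidable using (⌊_⌋)

-- A (simple, undirected) graph on vertex set V = Fin n, given by a Boolean
-- adjacency function; simplicity (symmetric, loopless) is imposed as
-- hypotheses in the statement.
Graph : ℕ → Set
Graph n = Fin n → Fin n → Bool

Symmetric : ∀ {n} → Graph n → Set
Symmetric {n} adj = (u v : Fin n) → adj u v ≡ adj v u

Loopless : ∀ {n} → Graph n → Set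
Loopless {n} adj = (v : Fin n) → adj v v ≡ false

countF : ∀ {n} → (Fin n → Bool) → ℕ
countF {zero} p = 0
countF {suc n} p = (if p zero then 1 else 0) + countF (λ i → p (suc i))

sumF : ∀ {n} → (Fin n → ℕ) → ℕ
sumF {zero} f = 0
sumF {suc n} f = f zero + sumF (λ i → f (suc i))

-- A 2-partition (V1, V2) is encoded by its side function: π v = true iff v ∈ V1.
-- (Unordered: π and not ∘ π describe the same partition; all notions below are
-- invariant under this swap.)
Partition : ℕ → Set
Partition n = Fin n → Bool

Trivial : ∀ {n} → Partition n → Set
Trivial π = countF π ≡ 0 ⊎ countF (λ v → not (π v)) ≡ 0

Extreme : ∀ {n} → Partition n → Set
Extreme π = countF π ≡ 1 ⊎ countF (λ v → not (π v)) ≡ 1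

sameSide : Bool → Bool → Bool
sameSide a b = not (a xor b)

conflict : ∀ {n} → Graph n → Partition n → Fin n → Fin n → Bool
conflict adj π u v =
  not ⌊ u ≟ v ⌋ ∧ (if sameSide (π u) (π v) then not (adj u v) else adj u v)

cost : ∀ {n} → Graph n → Partition n → Fin n → ℕ
cost adj π v = countF (λ u → conflict adj π u v)

h1 : ∀ {n} → Graph n → Partition n → ℕ
h1 adj π = sumF (cost adj π)

flip : ∀ {n} → Partition n → Subset n → Partition n
flip π F v = π v xor lookup F v

nbhdPartition : ∀ {n} → Graph n → Fin n → Partition n
nbhdPartition adj s v = ⌊ v ≟ s ⌋ Data.Bool.∨ adj v s

-- (K, t)-feasible flipping set, with the vertex bound t given as twoT = 2t
-- (so that half-integral t such as (n-1)/2 can be expressed over ℕ):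
-- h1(π ⊖ F) ≤ K and c_{π⊖F}(v) ≤ t, i.e. 2·c_{π⊖F}(v) ≤ twoT, for all v.
FeasibleHalf : ∀ {n} → Graph n → ℕ → ℕ → Partition n → Subset n → Set
FeasibleHalf {n} adj K twoT π F =
  h1 adj (flip π F) ≤ K × ((v : Fin n) → 2 * cost adj (flip π F) v ≤ twoT)

module Submission where

-- Start from any partition π with h₁(π) ≤ k and call it balanced if every
-- vertex has at most (n-1)/2 conflicts.  Moving an unbalanced vertex v to
-- the other cluster exchanges its c conflicts for the c' = (n-1) - c < c
-- complementary ones and changes h₁ by 2(c' - c), so h₁ strictly drops; by
-- well-founded induction on h₁ we reach a balanced π* with h₁(π*) ≤ k.
-- Averaging gives a vertex s with n·c_{π*}(s) ≤ h₁(π*) ≤ k, and flipping the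
-- set F of vertices in conflict with s turns (N[s], V∖N[s]) into π* up to
-- swapping clusters, so F is (k,(n-1)/2)-feasible with n·|F| ≤ k.  From the
-- hypotheses only h₁(π) ≤ k and n > 0 (π is non-trivial) are needed.

open import Defs
open import Data.Nat using (ℕ; _*_; _∸_; _≤_; _<_)
open import Data.Fin using (Fin)
open import Data.Fin.Subset using (Subset; ∣_∣)
open import Data.Product using (Σ; _×_)
open import Relation.Nullary using (¬_)

open import Data.Nat using (zero; suc; _+_; z≤n; _≤?_)
open import Data.Nat.Properties
open import Data.Nat.Induction using (<-wellFounded)
open import Data.Fin using (zero; suc) renaming (_≟_ to _≟F_)
open import Data.Fin.Properties using (all?; ¬∀⟶∃¬) renaming (suc-injective to Fin-suc-injective)
open import Data.Bool using (Bool; true; false; not; _∧_; _xor_; if_then_else_)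
open import Data.Vec using (tabulate)
open import Data.Vec.Properties using (lookup∘tabulate)
open import Data.Product using (_,_)
open import Data.Sum using (inj₁)
open import Data.Empty using (⊥-elim)
open import Induction.WellFounded using (Acc; acc)
open import Algebra.Properties.CommutativeSemigroup +-commutativeSemigroup
  using (interchange)
open import Relation.Nullary using (yes; no)
open import Relation.Nullary.Decidable using (⌊_⌋; isYes≗does; dec-true; dec-false)
open import Relation.Binary.PropositionalEquality

𝟙 : Bool → ℕ
𝟙 b = if b then 1 else 0

countF-as-sum : ∀ {n} (p : Fin n → Bool) → countF p ≡ sumF (λ i → 𝟙 (p i))
countF-as-sum {zero} p = refl
countF-as-sum {suc n} p = cong (𝟙 (p zero) +_) (countF-as-sum (λ i → p (suc i)))

sumF-cong : ∀ {n} {f g : Fin n → ℕ} → (∀ i → f i ≡ g i) → sumF f ≡ sumF g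
sumF-cong {zero} e = refl
sumF-cong {suc n} e = cong₂ _+_ (e zero) (sumF-cong (λ i → e (suc i)))

sumF-mono : ∀ {n} {f g : Fin n → ℕ} → (∀ i → f i ≤ g i) → sumF f ≤ sumF g
sumF-mono {zero} e = z≤n
sumF-mono {suc n} e = +-mono-≤ (e zero) (sumF-mono (λ i → e (suc i)))

sumF-+ : ∀ {n} (f g : Fin n → ℕ) → sumF (λ i → f i + g i) ≡ sumF f + sumF g
sumF-+ {zero} f g = refl
sumF-+ {suc n} f g =
  trans (cong (f zero + g zero +_) (sumF-+ (λ i → f (suc i)) (λ i → g (suc i))))
        (interchange (f zero) (g zero) _ _)

sumF-const : ∀ {n} (x : ℕ) → sumF {n} (λ _ → x) ≡ n * x
sumF-const {zero} x = refl
sumF-const {suc n} x = cong (x +_) (sumF-const {n} x)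

-- Changing a single summand: if f and g agree away from v, then
-- Σ f - f v = Σ g - g v, written without subtraction.  All counting
-- identities about moving one vertex are instances of this.
sumF-update : ∀ {n} (f g : Fin n → ℕ) (v : Fin n) →
  (∀ w → ¬ w ≡ v → f w ≡ g w) → sumF f + g v ≡ sumF g + f v
sumF-update {suc n} f g zero agree = begin
  f zero + sumF (λ i → f (suc i)) + g zero ≡⟨ cong (λ t → f zero + t + g zero) tails ⟩
  f zero + sumF (λ i → g (suc i)) + g zero ≡⟨ +-assoc (f zero) _ (g zero) ⟩
  f zero + (sumF (λ i → g (suc i)) + g zero) ≡⟨ +-comm (f zero) _ ⟩
  sumF (λ i → g (suc i)) + g zero + f zero ≡⟨ cong (_+ f zero) (+-comm _ (g zero)) ⟩
  g zero + sumF (λ i → g (suc i)) + f zero ∎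
  where
  open ≡-Reasoning
  tails : sumF (λ i → f (suc i)) ≡ sumF (λ i → g (suc i))
  tails = sumF-cong (λ i → agree (suc i) (λ ()))
sumF-update {suc n} f g (suc v) agree = begin
  f zero + sumF (λ i → f (suc i)) + g (suc v) ≡⟨ +-assoc (f zero) _ _ ⟩
  f zero + (sumF (λ i → f (suc i)) + g (suc v)) ≡⟨ cong₂ _+_ (agree zero (λ ())) tails ⟩
  g zero + (sumF (λ i → g (suc i)) + f (suc v)) ≡⟨ +-assoc (g zero) _ _ ⟨
  g zero + sumF (λ i → g (suc i)) + f (suc v) ∎
  where
  open ≡-Reasoning
  tails : sumF (λ i → f (suc i)) + g (suc v) ≡ sumF (λ i → g (suc i)) + f (suc v)
  tails = sumF-update (λ i → f (suc i)) (λ i → g (suc i)) v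
            (λ w w≢v → agree (suc w) (λ e → w≢v (Fin-suc-injective e)))

minimiser : ∀ {m} (f : Fin (suc m) → ℕ) → Σ (Fin (suc m)) λ s → ∀ u → f s ≤ f u
minimiser {zero} f = zero , λ { zero → ≤-refl }
minimiser {suc m} f with minimiser (λ i → f (suc i))
... | s , min with f zero ≤? f (suc s)
... | yes le = zero , λ { zero → ≤-refl ; (suc u) → ≤-trans le (min u) }
... | no nle = suc s , λ { zero → <⇒≤ (≰⇒> nle) ; (suc u) → min u }

averaging : ∀ {m} (f : Fin (suc m) → ℕ) → Σ (Fin (suc m)) λ s → suc m * f s ≤ sumF f
averaging {m} f with minimiser f
... | s , min = s , subst (_≤ sumF f) (sumF-const {suc m} (f s)) (sumF-mono min)

≟-refl : ∀ {n} (v : Fin n) → ⌊ v ≟F v ⌋ ≡ true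
≟-refl v = trans (isYes≗does (v ≟F v)) (dec-true (v ≟F v) refl)

≟-distinct : ∀ {n} {u v : Fin n} → ¬ u ≡ v → ⌊ u ≟F v ⌋ ≡ false
≟-distinct {u = u} {v} u≢v = trans (isYes≗does (u ≟F v)) (dec-false (u ≟F v) u≢v)

≟-sym : ∀ {n} (u v : Fin n) → ⌊ u ≟F v ⌋ ≡ ⌊ v ≟F u ⌋
≟-sym u v with u ≟F v | v ≟F u
... | yes _ | yes _ = refl
... | no _ | no _ = refl
... | yes u≡v | no v≢u = ⊥-elim (v≢u (sym u≡v))
... | no u≢v | yes v≡u = ⊥-elim (u≢v (sym v≡u))

sameSide-refl : ∀ a → sameSide a a ≡ true
sameSide-refl false = refl
sameSide-refl true = refl

sameSide-sym : ∀ a b → sameSide a b ≡ sameSide b a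
sameSide-sym false false = refl
sameSide-sym false true = refl
sameSide-sym true false = refl
sameSide-sym true true = refl

sameSide-not : ∀ a b → sameSide a (not b) ≡ not (sameSide a b)
sameSide-not false false = refl
sameSide-not false true = refl
sameSide-not true false = refl
sameSide-not true true = refl

sameSide-relative : ∀ a b c → sameSide (sameSide a c) (sameSide b c) ≡ sameSide a b
sameSide-relative false false false = refl
sameSide-relative false false true = refl
sameSide-relative false true false = refl
sameSide-relative false true true = refl
sameSide-relative true false false = refl
sameSide-relative true false true = refl
sameSide-relative true true false = refl
sameSide-relative true true true = refl

clash-not : ∀ same e → (if not same then not e else e) ≡ not (if same then not e else e)
clash-not false false = refl
clash-not false true = refl
clash-not true false = refl
clash-not true true = refl

xor-clash : ∀ same e → e xor (if same then not e else e) ≡ same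
xor-clash false false = refl
xor-clash false true = refl
xor-clash true false = refl
xor-clash true true = refl

𝟙-complement : ∀ b → 𝟙 b + 𝟙 (not b) ≡ 1
𝟙-complement false = refl
𝟙-complement true = refl

module _ {n} (adj : Graph n) where

  conflict-self : (π : Partition n) (v : Fin n) → conflict adj π v v ≡ false
  conflict-self π v rewrite ≟-refl v = refl

  conflict-distinct : (π : Partition n) {u w : Fin n} → ¬ u ≡ w →
    conflict adj π u w ≡ (if sameSide (π u) (π w) then not (adj u w) else adj u w)
  conflict-distinct π u≢w rewrite ≟-distinct u≢w = refl

  conflict-sym : Symmetric adj → (π : Partition n) (u w : Fin n) →
    conflict adj π u w ≡ conflict adj π w u
  conflict-sym sy π u w
    rewrite ≟-sym u w | sameSide-sym (π u) (π w) | sy u w = refl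

  cost-as-sum : (π : Partition n) (u : Fin n) → cost adj π u ≡ sumF (λ w → 𝟙 (conflict adj π w u))
  cost-as-sum π u = countF-as-sum (λ w → conflict adj π w u)

  conflict-sameSide : (π ρ : Partition n) {u w : Fin n} →
    sameSide (ρ u) (ρ w) ≡ sameSide (π u) (π w) → conflict adj ρ u w ≡ conflict adj π u w
  conflict-sameSide π ρ {u} {w} e =
    cong (λ same → not ⌊ u ≟F w ⌋ ∧ (if same then not (adj u w) else adj u w)) e

  cost-sameSide : (π ρ : Partition n) →
    (∀ u w → sameSide (ρ u) (ρ w) ≡ sameSide (π u) (π w)) → ∀ u → cost adj ρ u ≡ cost adj π u
  cost-sameSide π ρ e u = begin
    cost adj ρ u                        ≡⟨ cost-as-sum ρ u ⟩
    sumF (λ w → 𝟙 (conflict adj ρ w u)) ≡⟨ sumF-cong (λ w → cong 𝟙 (conflict-sameSide π ρ (e w u))) ⟩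
    sumF (λ w → 𝟙 (conflict adj π w u)) ≡⟨ cost-as-sum π u ⟨
    cost adj π u ∎
    where open ≡-Reasoning

  cost-by-rows : Symmetric adj → (π : Partition n) (v : Fin n) →
    sumF (λ u → 𝟙 (conflict adj π v u)) ≡ cost adj π v
  cost-by-rows sy π v =
    trans (sumF-cong (λ u → cong 𝟙 (conflict-sym sy π v u))) (sym (cost-as-sum π v))

move : ∀ {n} → Partition n → Fin n → Partition n
move π v w = if ⌊ w ≟F v ⌋ then not (π w) else π w

move-at : ∀ {n} (π : Partition n) (v : Fin n) → move π v v ≡ not (π v)
move-at π v rewrite ≟-refl v = refl

move-away : ∀ {n} (π : Partition n) {v w : Fin n} → ¬ w ≡ v → move π v w ≡ π w
move-away π w≢v rewrite ≟-distinct w≢v = refl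

module Moving {n} (adj : Graph n) (π : Partition n) (v : Fin n) where

  π' : Partition n
  π' = move π v

  c c' : ℕ
  c = cost adj π v
  c' = cost adj π' v

  conflict-away : ∀ {w u} → ¬ w ≡ v → ¬ u ≡ v → conflict adj π' w u ≡ conflict adj π w u
  conflict-away w≢v u≢v =
    conflict-sameSide adj π π' (cong₂ sameSide (move-away π w≢v) (move-away π u≢v))

  conflict-toggled : ∀ {w} → ¬ w ≡ v → conflict adj π' w v ≡ not (conflict adj π w v)
  conflict-toggled {w} w≢v = begin
    conflict adj π' w v
      ≡⟨ conflict-distinct adj π' w≢v ⟩
    (if sameSide (π' w) (π' v) then not (adj w v) else adj w v)
      ≡⟨ cong (λ same → if same then not (adj w v) else adj w v) sides ⟩
    (if not (sameSide (π w) (π v)) then not (adj w v) else adj w v)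
      ≡⟨ clash-not (sameSide (π w) (π v)) (adj w v) ⟩
    not (if sameSide (π w) (π v) then not (adj w v) else adj w v)
      ≡⟨ cong not (conflict-distinct adj π w≢v) ⟨
    not (conflict adj π w v) ∎
    where
    open ≡-Reasoning
    sides : sameSide (π' w) (π' v) ≡ not (sameSide (π w) (π v))
    sides = trans (cong₂ sameSide (move-away π w≢v) (move-at π v)) (sameSide-not (π w) (π v))

  -- Every other vertex is in conflict with v either before or after the move.
  costs-complement : c + c' + 1 ≡ n
  costs-complement = begin
    c + c' + 1                ≡⟨ cong (_+ 1) (cong₂ _+_ (cost-as-sum adj π v) (cost-as-sum adj π' v)) ⟩
    sumF before + sumF after + 1 ≡⟨ cong (_+ 1) (sumF-+ before after) ⟨
    sumF both + 1             ≡⟨ sumF-update both (λ _ → 1) v complement ⟩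
    sumF {n} (λ _ → 1) + both v ≡⟨ cong₂ _+_ (sumF-const {n} 1) at-v ⟩
    n * 1 + 0                 ≡⟨ +-identityʳ (n * 1) ⟩
    n * 1                     ≡⟨ *-identityʳ n ⟩
    n ∎
    where
    open ≡-Reasoning
    before after both : Fin n → ℕ
    before w = 𝟙 (conflict adj π w v)
    after w = 𝟙 (conflict adj π' w v)
    both w = before w + after w
    complement : ∀ w → ¬ w ≡ v → both w ≡ 1
    complement w w≢v =
      trans (cong (λ b → before w + 𝟙 b) (conflict-toggled w≢v)) (𝟙-complement (conflict adj π w v))
    at-v : both v ≡ 0
    at-v = cong₂ (λ a b → 𝟙 a + 𝟙 b) (conflict-self adj π v) (conflict-self adj π' v)

  -- For u ≠ v only the conflict between u and v changes.
  cost-elsewhere : ∀ u → ¬ u ≡ v →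
    cost adj π' u + 𝟙 (conflict adj π v u) ≡ cost adj π u + 𝟙 (conflict adj π' v u)
  cost-elsewhere u u≢v = begin
    cost adj π' u + 𝟙 (conflict adj π v u)
      ≡⟨ cong (_+ 𝟙 (conflict adj π v u)) (cost-as-sum adj π' u) ⟩
    sumF (λ w → 𝟙 (conflict adj π' w u)) + 𝟙 (conflict adj π v u)
      ≡⟨ sumF-update _ _ v (λ w w≢v → cong 𝟙 (conflict-away w≢v u≢v)) ⟩
    sumF (λ w → 𝟙 (conflict adj π w u)) + 𝟙 (conflict adj π' v u)
      ≡⟨ cong (_+ 𝟙 (conflict adj π' v u)) (cost-as-sum adj π u) ⟨
    cost adj π u + 𝟙 (conflict adj π' v u) ∎
    where open ≡-Reasoning

  h1-move : Symmetric adj → h1 adj π' + c + c ≡ h1 adj π + c' + c'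
  h1-move sy = begin
    h1 adj π' + c + c ≡⟨ cong₂ _+_ (row-sum π' π) (drop-self π π') ⟨
    sumF (shifted π' π) + shifted π π' v ≡⟨ sumF-update (shifted π' π) (shifted π π') v cost-elsewhere ⟩
    sumF (shifted π π') + shifted π' π v ≡⟨ cong₂ _+_ (row-sum π π') (drop-self π' π) ⟩
    h1 adj π + c' + c' ∎
    where
    open ≡-Reasoning
    shifted : Partition n → Partition n → Fin n → ℕ
    shifted ρ σ u = cost adj ρ u + 𝟙 (conflict adj σ v u)
    row-sum : ∀ ρ σ → sumF (shifted ρ σ) ≡ h1 adj ρ + cost adj σ v
    row-sum ρ σ = trans (sumF-+ (cost adj ρ) _) (cong (h1 adj ρ +_) (cost-by-rows adj sy σ v))
    drop-self : ∀ ρ σ → shifted ρ σ v ≡ cost adj ρ v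
    drop-self ρ σ = trans (cong (λ b → cost adj ρ v + 𝟙 b) (conflict-self adj σ v)) (+-identityʳ _)

  move-decreases : Symmetric adj → ¬ (2 * c ≤ n ∸ 1) → h1 adj π' < h1 adj π
  move-decreases sy unbalanced =
    exchange-decreases (h1-move sy) (larger-share costs-complement unbalanced)
    where
    larger-share : ∀ {a b m} → a + b + 1 ≡ m → ¬ (2 * a ≤ m ∸ 1) → b < a
    larger-share {a} {b} refl too-many =
      subst (b <_) (+-identityʳ a)
        (+-cancelˡ-< a b (a + 0) (subst (_< 2 * a) (m+n∸n≡m (a + b) 1) (≰⇒> too-many)))
    exchange-decreases : ∀ {h h′ a b} → h′ + a + a ≡ h + b + b → b < a → h′ < h
    exchange-decreases {h} {h′} {a} {b} e b<a =
      +-cancelʳ-< a h′ h (+-cancelʳ-< a (h′ + a) (h + a)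
        (subst (_< h + a + a) (sym e) (+-mono-< (+-monoʳ-< h b<a) b<a)))

Balanced : ∀ {n} → Graph n → Partition n → Set
Balanced {n} adj π = ∀ v → 2 * cost adj π v ≤ n ∸ 1

balance : ∀ {n} (adj : Graph n) → Symmetric adj → (π : Partition n) → Acc _<_ (h1 adj π) →
  Σ (Partition n) λ π* → Balanced adj π* × h1 adj π* ≤ h1 adj π
balance {n} adj sy π (acc smaller) with all? (λ v → 2 * cost adj π v ≤? n ∸ 1)
... | yes balanced = π , balanced , ≤-refl
... | no unbalanced with ¬∀⟶∃¬ n _ (λ v → 2 * cost adj π v ≤? n ∸ 1) unbalanced
...   | v , too-many = improve (balance adj sy (move π v) (smaller decrease))
  where
  decrease : h1 adj (move π v) < h1 adj π
  decrease = Moving.move-decreases adj π v sy too-many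
  improve : Σ (Partition n) (λ π* → Balanced adj π* × h1 adj π* ≤ h1 adj (move π v)) →
            Σ (Partition n) (λ π* → Balanced adj π* × h1 adj π* ≤ h1 adj π)
  improve (π* , balanced , le) = π* , balanced , ≤-trans le (<⇒≤ decrease)

conflictSet : ∀ {n} → Graph n → Partition n → Fin n → Subset n
conflictSet adj π s = tabulate (λ w → conflict adj π w s)

∣tabulate∣ : ∀ {n} (p : Fin n → Bool) → ∣ tabulate p ∣ ≡ countF p
∣tabulate∣ {zero} p = refl
∣tabulate∣ {suc n} p with p zero
... | true = cong suc (∣tabulate∣ (λ i → p (suc i)))
... | false = ∣tabulate∣ (λ i → p (suc i))

nbhdFlip : ∀ {n} → Graph n → Partition n → Fin n → Partition n
nbhdFlip adj π s = flip (nbhdPartition adj s) (conflictSet adj π s)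

-- nbhdFlip puts w in the cluster of s exactly when w is with s in π.  Deciding
-- w ≟ s settles both N[s]-membership and the distinctness test of conflict.
flip-nbhd : ∀ {n} (adj : Graph n) (π : Partition n) (s w : Fin n) →
  nbhdFlip adj π s w ≡ sameSide (π w) (π s)
flip-nbhd adj π s w rewrite lookup∘tabulate (λ u → conflict adj π u s) w with w ≟F s
... | yes refl = sym (sameSide-refl (π s))
... | no _ = xor-clash (sameSide (π w) (π s)) (adj w s)

-- Hence this flip reproduces π up to swapping the clusters, and so has the
-- same conflict counts.
cost-flip-nbhd : ∀ {n} (adj : Graph n) (π : Partition n) (s u : Fin n) →
  cost adj (nbhdFlip adj π s) u ≡ cost adj π u
cost-flip-nbhd adj π s = cost-sameSide adj π (nbhdFlip adj π s) λ u w →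
  trans (cong₂ sameSide (flip-nbhd adj π s u) (flip-nbhd adj π s w))
        (sameSide-relative (π u) (π w) (π s))

-- A balanced partition with h₁ ≤ k yields the required flipping set: take
-- the neighbourhood partition of a vertex s with fewest conflicts.
flipping-set : ∀ {m} (adj : Graph (suc m)) (k : ℕ) (π : Partition (suc m)) →
  Balanced adj π → h1 adj π ≤ k →
  Σ (Fin (suc m)) (λ s → Σ (Subset (suc m)) (λ F →
    FeasibleHalf adj k m (nbhdPartition adj s) F × suc m * ∣ F ∣ ≤ k))
flipping-set {m} adj k π balanced h1≤k with averaging (cost adj π)
... | s , few = s , conflictSet adj π s , (h1-flip , cost-flip) , size
  where
  h1-flip : h1 adj (nbhdFlip adj π s) ≤ k
  h1-flip = subst (_≤ k) (sym (sumF-cong (cost-flip-nbhd adj π s))) h1≤k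
  cost-flip : ∀ v → 2 * cost adj (nbhdFlip adj π s) v ≤ m
  cost-flip v = subst (λ c → 2 * c ≤ m) (sym (cost-flip-nbhd adj π s v)) (balanced v)
  size : suc m * ∣ conflictSet adj π s ∣ ≤ k
  size = subst (λ c → suc m * c ≤ k) (sym (∣tabulate∣ (λ w → conflict adj π w s)))
           (≤-trans few h1≤k)

lemma7 : {n : ℕ} (adj : Graph n) → Symmetric adj → Loopless adj → (k : ℕ) →
    ((π : Partition n) → Extreme π → k < h1 adj π) →
    Σ (Partition n) (λ π → ¬ Trivial π × ¬ Extreme π × h1 adj π ≤ k) →
    Σ (Fin n) (λ s → Σ (Subset n) (λ F →
    FeasibleHalf adj k (n ∸ 1) (nbhdPartition adj s) F × n * ∣ F ∣ ≤ k))
lemma7 {zero} _ _ _ _ _ (_ , nontrivial , _) = ⊥-elim (nontrivial (inj₁ refl))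
lemma7 {suc m} adj sy _ k _ (π , _ , _ , h1≤k)
  with balance adj sy π (<-wellFounded (h1 adj π))
... | π* , balanced , improved = flipping-set adj k π* balanced (≤-trans improved h1≤k)
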